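{- Let $M$ be a marking for a permutation $\pi\in S_n$. Then $M$ is s-balanced if and only if it is ms-balanced.
   Context: $\pi=[\dots a\dots b\dots]$ means $a$ occurs at an earlier position than $b$ in $\pi$. An inversion of $\pi$ is a pair $(a,b)$ with $a>b$ and $\pi=[\dots a\dots b\dots]$. Element $i$ is right if in some inversion $(i,j)$, left if in some inversion $(j,i)$; left-straight if left but not right; right-straight if right but not left; straight if left- or right-straight; a switchback if both left and right. A marking for $\pi$ is a function $M$ from $\{1,\dots,n\}$ to strings in letters $L,R$ with $M(i)=L$ for left-straight $i$, $M(i)=R$ for right-straight $i$, $M(i)\in\{LR,RL\}$ for switchbacks, and $M(i)=\emptyset$ otherwise. A quadruple $(a,b,c,d)$ is a rec in $\pi$ if $\pi=[\dots a\dots b\dots c\dots d\dots]$ and $\min\{a,b\}>\max\{c,d\}$. Under $M$, $e$ is a left switchback of the rec if $M(e)=RL$, $\pi=[\dots a\dots e\dots b\dots]$, and $e$ is strictly between $c$ and $d$ in value; a right switchback if $M(e)=LR$, $\pi=[\dots c\dots e\dots d\dots]$, and $e$ is strictly between $a$ and $b$ in value. The rec is regular if $a<b$ and $c<d$, irregular otherwise; balanced if it has equally many left and right switchbacks; empty if it has none; straight if $a,b,c,d$ are all straight. A pair $a,b$ is right (resp. left) minimal if $a,b$ are right-straight (resp. left-straight) elements, $a<b$, and there is no right-straight (resp. left-straight) element $c$ with $\pi=[\dots a\dots c\dots b\dots]$. A rec $(a,b,c,d)$ is minimal if $a,b$ is a right minimal pair and $c,d$ is a left minimal pair. $M$ is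 s-balanced if every straight rec is balanced and every irregular rec is empty under $M$; $M$ is ms-balanced if every minimal regular rec is balanced and every irregular rec is empty under $M$. -}

module Defs where

open import Data.Nat using (ℕ)
open import Data.Fin using (Fin; _<_; _<?_)
open import Data.Fin.Permutation using (Permutation′; _⟨$⟩ˡ_)
open import Data.List using (List; []; _∷_; length; filter; allFin)
open import Data.List.Properties using (≡-dec)
open import Data.Product using (_×_; ∃-syntax)
open import Data.Sum using (_⊎_)
open import Data.Empty using (⊥)
open import Relation.Nullary using (¬_; Dec; yes; no)
open import Relation.Nullary.Decidable using (_×-dec_; _⊎-dec_)
open import Relation.Binary.PropositionalEquality using (_≡_; refl)

-- Elements 1..n are represented by Fin n (element i+1 is Fin value i);
-- positions are also Fin n.  π ⟨$⟩ʳ p is the entry at position p, so the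
-- position of element a is π ⟨$⟩ˡ a.

data Letter : Set where
  L R : Letter

_≟L_ : (x y : Letter) → Dec (x ≡ y)
L ≟L L = yes refl
L ≟L R = no λ ()
R ≟L L = no λ ()
R ≟L R = yes refl

Word : Set
Word = List Letter

LR RL : Word
LR = L ∷ R ∷ []
RL = R ∷ L ∷ []

module _ {n : ℕ} (π : Permutation′ n) where

  Before : Fin n → Fin n → Set
  Before a b = (π ⟨$⟩ˡ a) < (π ⟨$⟩ˡ b)

  before? : (a b : Fin n) → Dec (Before a b)
  before? a b = (π ⟨$⟩ˡ a) <? (π ⟨$⟩ˡ b)

  Inversion : Fin n → Fin n → Set
  Inversion a b = b < a × Before a b

  IsRight IsLeft : Fin n → Set
  IsRight i = ∃[ j ] Inversion i j
  IsLeft  i = ∃[ j ] Inversion j i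

  LeftStraight RightStraight Straight Switchback : Fin n → Set
  LeftStraight i = IsLeft i × ¬ IsRight i
  RightStraight i = IsRight i × ¬ IsLeft i
  Straight i = LeftStraight i ⊎ RightStraight i
  Switchback i = IsLeft i × IsRight i

  IsMarking : (Fin n → Word) → Set
  IsMarking M = ∀ i →
      (LeftStraight i → M i ≡ L ∷ [])
    × (RightStraight i → M i ≡ R ∷ [])
    × (Switchback i → M i ≡ LR ⊎ M i ≡ RL)
    × (¬ IsLeft i → ¬ IsRight i → M i ≡ [])

  Rec : Fin n → Fin n → Fin n → Fin n → Set
  Rec a b c d = Before a b × Before b c × Before c d
              × (c < a × d < a × c < b × d < b)

  Between : Fin n → Fin n → Fin n → Set
  Between x y e = (x < e × e < y) ⊎ (y < e × e < x)

  between? : (x y e : Fin n) → Dec (Between x y e)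
  between? x y e = ((x <? e) ×-dec (e <? y)) ⊎-dec ((y <? e) ×-dec (e <? x))

  module _ (M : Fin n → Word) where

    LeftSwitchback : Fin n → Fin n → Fin n → Fin n → Fin n → Set
    LeftSwitchback a b c d e = M e ≡ RL × Before a e × Before e b × Between c d e

    RightSwitchback : Fin n → Fin n → Fin n → Fin n → Fin n → Set
    RightSwitchback a b c d e = M e ≡ LR × Before c e × Before e d × Between a b e

    leftSwitchback? : ∀ a b c d e → Dec (LeftSwitchback a b c d e)
    leftSwitchback? a b c d e =
      ≡-dec _≟L_ (M e) RL ×-dec before? a e ×-dec before? e b ×-dec between? c d e

    rightSwitchback? : ∀ a b c d e → Dec (RightSwitchback a b c d e)
    rightSwitchback? a b c d e =
      ≡-dec _≟L_ (M e) LR ×-dec before? c e ×-dec before? e d ×-dec between? a b e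

    #LeftSwitchbacks #RightSwitchbacks : Fin n → Fin n → Fin n → Fin n → ℕ
    #LeftSwitchbacks a b c d = length (filter (leftSwitchback? a b c d) (allFin n))
    #RightSwitchbacks a b c d = length (filter (rightSwitchback? a b c d) (allFin n))

    Balanced : Fin n → Fin n → Fin n → Fin n → Set
    Balanced a b c d = #LeftSwitchbacks a b c d ≡ #RightSwitchbacks a b c d

    Empty : Fin n → Fin n → Fin n → Fin n → Set
    Empty a b c d = ∀ e → ¬ LeftSwitchback a b c d e × ¬ RightSwitchback a b c d e

  Regular : Fin n → Fin n → Fin n → Fin n → Set
  Regular a b c d = a < b × c < d

  Irregular : Fin n → Fin n → Fin n → Fin n → Set
  Irregular a b c d = ¬ Regular a b c d

  StraightRec : Fin n → Fin n → Fin n → Fin n → Set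
  StraightRec a b c d = Straight a × Straight b × Straight c × Straight d

  RightMinimal LeftMinimal : Fin n → Fin n → Set
  RightMinimal a b = RightStraight a × RightStraight b × a < b
    × (∀ c → RightStraight c → Before a c → Before c b → ⊥)
  LeftMinimal a b = LeftStraight a × LeftStraight b × a < b
    × (∀ c → LeftStraight c → Before a c → Before c b → ⊥)

  MinimalRec : Fin n → Fin n → Fin n → Fin n → Set
  MinimalRec a b c d = Rec a b c d × RightMinimal a b × LeftMinimal c d

  SBalanced : (Fin n → Word) → Set
  SBalanced M =
      (∀ a b c d → Rec a b c d → StraightRec a b c d → Balanced M a b c d)
    × (∀ a b c d → Rec a b c d → Irregular a b c d → Empty M a b c d)

  MSBalanced : (Fin n → Word) → Set
  MSBalanced M =
      (∀ a b c d → MinimalRec a b c d → Regular a b c d → Balanced M a b c d)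
    × (∀ a b c d → Rec a b c d → Irregular a b c d → Empty M a b c d)

-- Straight elements occupy a special place: a right-straight element lies
-- below every right-straight element to its right (an inversion with a later
-- one would make that one left), and dually for left-straight elements.  So
-- a straight rec (a,b,c,d) has a, b right-straight and c, d left-straight and
-- is regular.  A right-straight r strictly between a and b in position is
-- also strictly between them in value, and since M r = R it is no switchback;
-- hence both switchback counts of (a,b,c,d) are the sums of those of
-- (a,r,c,d) and (r,b,c,d).  Refining (a,b) and then (c,d) through all
-- intermediate straight elements reduces balance of every straight rec to
-- balance of minimal regular recs.
module Submission where

open import Defs
open import Data.Nat using (ℕ; suc; _+_; _∸_)
import Data.Nat as ℕ
open import Data.Nat.Properties using (+-suc; ∸-monoˡ-<; ∸-monoʳ-<; <⇒≤)
import Data.Nat.Properties as ℕₚ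
open import Data.Nat.Induction using (<-wellFounded)
open import Data.Fin using (Fin; toℕ; _<_; _<?_)
open import Data.Fin.Properties using (any?; <-cmp; <-trans; <-asym)
open import Data.Fin.Permutation using (Permutation′; _⟨$⟩ˡ_; _⟨$⟩ʳ_; inverseʳ)
open import Data.List using ([]; _∷_; length; filter; allFin)
open import Data.Product using (_×_; _,_; proj₁; proj₂)
open import Data.Sum using (_⊎_; inj₁; inj₂; [_,_]′)
import Data.Sum as ⊎
open import Data.Empty using (⊥; ⊥-elim)
open import Function.Bundles using (_⇔_; mk⇔)
open import Induction.WellFounded using (Acc; acc)
open import Relation.Binary using (tri<; tri≈; tri>)
open import Relation.Nullary using (¬_; Dec; yes; no; contradiction)
open import Relation.Nullary.Decidable using (_×-dec_; ¬?)
open import Relation.Binary.PropositionalEquality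
  using (_≡_; _≢_; refl; sym; trans; cong; cong₂; module ≡-Reasoning)

module _ {A : Set} {P Q S : A → Set}
         (P? : ∀ x → Dec (P x)) (Q? : ∀ x → Dec (Q x)) (S? : ∀ x → Dec (S x)) where

  length-filter-⊎ : (∀ {x} → P x → Q x ⊎ S x) → (∀ {x} → Q x ⊎ S x → P x) →
    (∀ {x} → Q x → ¬ S x) →
    ∀ xs → length (filter P? xs) ≡ length (filter Q? xs) + length (filter S? xs)
  length-filter-⊎ P⇒ ⇒P disjoint [] = refl
  length-filter-⊎ P⇒ ⇒P disjoint (x ∷ xs) with P? x | Q? x | S? x
  ... | _     | yes q | yes s = contradiction s (disjoint q)
  ... | yes _ | yes _ | no _  = cong suc (length-filter-⊎ P⇒ ⇒P disjoint xs)
  ... | yes _ | no _  | yes _ =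
    trans (cong suc (length-filter-⊎ P⇒ ⇒P disjoint xs)) (sym (+-suc _ _))
  ... | yes p | no ¬q | no ¬s = ⊥-elim ([ ¬q , ¬s ]′ (P⇒ p))
  ... | no ¬p | yes q | _     = contradiction (⇒P (inj₁ q)) ¬p
  ... | no ¬p | no _  | yes s = contradiction (⇒P (inj₂ s)) ¬p
  ... | no _  | no _  | no _  = length-filter-⊎ P⇒ ⇒P disjoint xs

module _ {n : ℕ} (rank : Fin n → ℕ) {S : Fin n → Set} (S? : ∀ x → Dec (S x)) where

  private
    _≺_ : Fin n → Fin n → Set
    x ≺ y = rank x ℕ.< rank y

  NothingBetween : Fin n → Fin n → Set
  NothingBetween x y = ∀ r → S r → x ≺ r → r ≺ y → ⊥

  refinement-induction : (Q : Fin n → Fin n → Set) →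
    (∀ {x y} → S x → S y → x ≺ y → NothingBetween x y → Q x y) →
    (∀ {x r y} → S x → S r → S y → x ≺ r → r ≺ y → Q x r → Q r y → Q x y) →
    ∀ {x y} → S x → S y → x ≺ y → Q x y
  refinement-induction Q base step {x} {y} = go (<-wellFounded (rank y ∸ rank x))
    where
    go : ∀ {x y} → Acc ℕ._<_ (rank y ∸ rank x) → S x → S y → x ≺ y → Q x y
    go {x} {y} (acc smaller) sx sy x≺y
      with any? (λ r → S? r ×-dec (rank x ℕ.<? rank r) ×-dec (rank r ℕ.<? rank y))
    ... | no none = base sx sy x≺y (λ r sr x≺r r≺y → none (r , sr , x≺r , r≺y))
    ... | yes (r , sr , x≺r , r≺y) = step sx sr sy x≺r r≺y
      (go (smaller (∸-monoˡ-< r≺y (<⇒≤ x≺r))) sx sr x≺r)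
      (go (smaller (∸-monoʳ-< x≺r (<⇒≤ r≺y))) sr sy r≺y)

module _ {n : ℕ} (π : Permutation′ n) where

  position : Fin n → ℕ
  position x = toℕ (π ⟨$⟩ˡ x)

  Before-total : ∀ {x y} → x ≢ y → Before π x y ⊎ Before π y x
  Before-total {x} {y} x≢y with <-cmp (π ⟨$⟩ˡ x) (π ⟨$⟩ˡ y)
  ... | tri< x≺y _ _ = inj₁ x≺y
  ... | tri≈ _ eq _  = contradiction x≡y x≢y
    where
    x≡y : x ≡ y
    x≡y = trans (sym (inverseʳ π)) (trans (cong (π ⟨$⟩ʳ_) eq) (inverseʳ π))
  ... | tri> _ _ y≺x = inj₂ y≺x

  Before-trans : ∀ {x y z} → Before π x y → Before π y z → Before π x z
  Before-trans = ℕₚ.<-trans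

  Before⇒<-of-¬IsLeft : ∀ {x y} → ¬ IsLeft π y → Before π x y → x < y
  Before⇒<-of-¬IsLeft {x} {y} ¬left x≺y with <-cmp x y
  ... | tri< x<y _ _ = x<y
  ... | tri≈ _ refl _ = contradiction x≺y (ℕₚ.<-irrefl refl)
  ... | tri> _ _ y<x = contradiction (x , y<x , x≺y) ¬left

  Before⇒<-of-¬IsRight : ∀ {x y} → ¬ IsRight π x → Before π x y → x < y
  Before⇒<-of-¬IsRight {x} {y} ¬right x≺y with <-cmp x y
  ... | tri< x<y _ _ = x<y
  ... | tri≈ _ refl _ = contradiction x≺y (ℕₚ.<-irrefl refl)
  ... | tri> _ _ y<x = contradiction (y , y<x , x≺y) ¬right

  Straight∧IsRight⇒RightStraight : ∀ {x} → Straight π x → IsRight π x → RightStraight π x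
  Straight∧IsRight⇒RightStraight (inj₁ (_ , ¬right)) right = contradiction right ¬right
  Straight∧IsRight⇒RightStraight (inj₂ rs)           _     = rs

  Straight∧IsLeft⇒LeftStraight : ∀ {x} → Straight π x → IsLeft π x → LeftStraight π x
  Straight∧IsLeft⇒LeftStraight (inj₁ ls)           _    = ls
  Straight∧IsLeft⇒LeftStraight (inj₂ (_ , ¬left)) left = contradiction left ¬left

  isRight? : ∀ x → Dec (IsRight π x)
  isRight? x = any? (λ j → (j <? x) ×-dec before? π x j)

  isLeft? : ∀ x → Dec (IsLeft π x)
  isLeft? x = any? (λ j → (x <? j) ×-dec before? π j x)

  rightStraight? : ∀ x → Dec (RightStraight π x)
  rightStraight? x = isRight? x ×-dec ¬? (isLeft? x)

  leftStraight? : ∀ x → Dec (LeftStraight π x)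
  leftStraight? x = isLeft? x ×-dec ¬? (isRight? x)

  Between⇒< : ∀ {x y e} → x < y → Between π x y e → x < e × e < y
  Between⇒< _   (inj₁ x<e<y)       = x<e<y
  Between⇒< x<y (inj₂ (y<e , e<x)) = ⊥-elim (<-asym x<y (<-trans y<e e<x))

  Between-split : ∀ {x r y e} → x < r → r < y → e ≢ r →
    Between π x y e → Between π x r e ⊎ Between π r y e
  Between-split {r = r} {e = e} x<r r<y e≢r between with Between⇒< (<-trans x<r r<y) between
  ... | x<e , e<y with <-cmp e r
  ...   | tri< e<r _ _ = inj₁ (inj₁ (x<e , e<r))
  ...   | tri≈ _ e≡r _ = contradiction e≡r e≢r
  ...   | tri> _ _ r<e = inj₂ (inj₁ (r<e , e<y))

  Between-left : ∀ {x r y e} → x < r → r < y → Between π x r e → Between π x y e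
  Between-left x<r r<y between with Between⇒< x<r between
  ... | x<e , e<r = inj₁ (x<e , <-trans e<r r<y)

  Between-right : ∀ {x r y e} → x < r → r < y → Between π r y e → Between π x y e
  Between-right x<r r<y between with Between⇒< r<y between
  ... | r<e , e<y = inj₁ (<-trans x<r r<e , e<y)

  Between-disjoint : ∀ {x r y e} → x < r → r < y →
    Between π x r e → ¬ Between π r y e
  Between-disjoint x<r r<y b₁ b₂ = <-asym (proj₂ (Between⇒< x<r b₁)) (proj₁ (Between⇒< r<y b₂))

  Before-split : ∀ {x r y e} → e ≢ r → Before π x e → Before π e y →
    (Before π x e × Before π e r) ⊎ (Before π r e × Before π e y)
  Before-split e≢r x≺e e≺y with Before-total e≢r
  ... | inj₁ e≺r = inj₁ (x≺e , e≺r)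
  ... | inj₂ r≺e = inj₂ (r≺e , e≺y)

  module _ (M : Fin n → Word) where

    Marked-≢ : ∀ {e r w v} → M e ≡ w → M r ≡ v → w ≢ v → e ≢ r
    Marked-≢ me mr w≢v refl = w≢v (trans (sym me) mr)

    -- r is marked R: it cannot itself be a switchback, so the switchbacks of
    -- (a,b,c,d) are split by r between (a,r,c,d) and (r,b,c,d).
    Balanced-splitᵃᵇ : ∀ {a r b c d} → M r ≡ R ∷ [] →
      Before π a r → Before π r b → a < r → r < b →
      Balanced π M a r c d → Balanced π M r b c d → Balanced π M a b c d
    Balanced-splitᵃᵇ {a} {r} {b} {c} {d} mr a≺r r≺b a<r r<b bal₁ bal₂ = begin
      #LeftSwitchbacks π M a b c d                                ≡⟨ #left-split ⟩
      #LeftSwitchbacks π M a r c d + #LeftSwitchbacks π M r b c d ≡⟨ cong₂ _+_ bal₁ bal₂ ⟩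
      #RightSwitchbacks π M a r c d + #RightSwitchbacks π M r b c d ≡⟨ sym #right-split ⟩
      #RightSwitchbacks π M a b c d                               ∎
      where
      open ≡-Reasoning
      #left-split : #LeftSwitchbacks π M a b c d ≡
                    #LeftSwitchbacks π M a r c d + #LeftSwitchbacks π M r b c d
      #left-split = length-filter-⊎
        (leftSwitchback? π M a b c d) (leftSwitchback? π M a r c d) (leftSwitchback? π M r b c d)
        (λ (m , a≺e , e≺b , v) → ⊎.map (λ (a≺e , e≺r) → m , a≺e , e≺r , v)
                                              (λ (r≺e , e≺b) → m , r≺e , e≺b , v)
                                              (Before-split (Marked-≢ m mr λ ()) a≺e e≺b))
        (λ { (inj₁ (m , a≺e , e≺r , v)) → m , a≺e , Before-trans e≺r r≺b , v
           ; (inj₂ (m , r≺e , e≺b , v)) → m , Before-trans a≺r r≺e , e≺b , v })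
        (λ (_ , _ , e≺r , _) (_ , r≺e , _ , _) → ℕₚ.<-asym e≺r r≺e)
        (allFin n)
      #right-split : #RightSwitchbacks π M a b c d ≡
                     #RightSwitchbacks π M a r c d + #RightSwitchbacks π M r b c d
      #right-split = length-filter-⊎
        (rightSwitchback? π M a b c d) (rightSwitchback? π M a r c d) (rightSwitchback? π M r b c d)
        (λ (m , c≺e , e≺d , v) → ⊎.map (λ v → m , c≺e , e≺d , v) (λ v → m , c≺e , e≺d , v)
                                              (Between-split a<r r<b (Marked-≢ m mr λ ()) v))
        (λ { (inj₁ (m , c≺e , e≺d , v)) → m , c≺e , e≺d , Between-left a<r r<b v
           ; (inj₂ (m , c≺e , e≺d , v)) → m , c≺e , e≺d , Between-right a<r r<b v })
        (λ (_ , _ , _ , v₁) (_ , _ , _ , v₂) → Between-disjoint a<r r<b v₁ v₂)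
        (allFin n)

    Balanced-splitᶜᵈ : ∀ {a b c l d} → M l ≡ L ∷ [] →
      Before π c l → Before π l d → c < l → l < d →
      Balanced π M a b c l → Balanced π M a b l d → Balanced π M a b c d
    Balanced-splitᶜᵈ {a} {b} {c} {l} {d} ml c≺l l≺d c<l l<d bal₁ bal₂ = begin
      #LeftSwitchbacks π M a b c d                                ≡⟨ #left-split ⟩
      #LeftSwitchbacks π M a b c l + #LeftSwitchbacks π M a b l d ≡⟨ cong₂ _+_ bal₁ bal₂ ⟩
      #RightSwitchbacks π M a b c l + #RightSwitchbacks π M a b l d ≡⟨ sym #right-split ⟩
      #RightSwitchbacks π M a b c d                               ∎
      where
      open ≡-Reasoning
      #left-split : #LeftSwitchbacks π M a b c d ≡
                    #LeftSwitchbacks π M a b c l + #LeftSwitchbacks π M a b l d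
      #left-split = length-filter-⊎
        (leftSwitchback? π M a b c d) (leftSwitchback? π M a b c l) (leftSwitchback? π M a b l d)
        (λ (m , a≺e , e≺b , v) → ⊎.map (λ v → m , a≺e , e≺b , v) (λ v → m , a≺e , e≺b , v)
                                              (Between-split c<l l<d (Marked-≢ m ml λ ()) v))
        (λ { (inj₁ (m , a≺e , e≺b , v)) → m , a≺e , e≺b , Between-left c<l l<d v
           ; (inj₂ (m , a≺e , e≺b , v)) → m , a≺e , e≺b , Between-right c<l l<d v })
        (λ (_ , _ , _ , v₁) (_ , _ , _ , v₂) → Between-disjoint c<l l<d v₁ v₂)
        (allFin n)
      #right-split : #RightSwitchbacks π M a b c d ≡
                     #RightSwitchbacks π M a b c l + #RightSwitchbacks π M a b l d
      #right-split = length-filter-⊎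
        (rightSwitchback? π M a b c d) (rightSwitchback? π M a b c l) (rightSwitchback? π M a b l d)
        (λ (m , c≺e , e≺d , v) → ⊎.map (λ (c≺e , e≺l) → m , c≺e , e≺l , v)
                                              (λ (l≺e , e≺d) → m , l≺e , e≺d , v)
                                              (Before-split (Marked-≢ m ml λ ()) c≺e e≺d))
        (λ { (inj₁ (m , c≺e , e≺l , v)) → m , c≺e , Before-trans e≺l l≺d , v
           ; (inj₂ (m , l≺e , e≺d , v)) → m , Before-trans c≺l l≺e , e≺d , v })
        (λ (_ , _ , e≺l , _) (_ , l≺e , _ , _) → ℕₚ.<-asym e≺l l≺e)
        (allFin n)

module _ {n : ℕ} (π : Permutation′ n) (M : Fin n → Word) where

  SBalanced⇒MSBalanced : SBalanced π M → MSBalanced π M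
  SBalanced⇒MSBalanced (straight-balanced , irregular-empty) =
    (λ a b c d (rec , (ra , rb , _) , (lc , ld , _)) _ →
       straight-balanced a b c d rec (inj₂ ra , inj₂ rb , inj₁ lc , inj₁ ld))
    , irregular-empty

  module _ (marking : IsMarking π M)
           (minimal-balanced : ∀ a b c d → MinimalRec π a b c d → Regular π a b c d →
                               Balanced π M a b c d) where

    RightStraight⇒R : ∀ {x} → RightStraight π x → M x ≡ R ∷ []
    RightStraight⇒R {x} = proj₁ (proj₂ (marking x))

    LeftStraight⇒L : ∀ {x} → LeftStraight π x → M x ≡ L ∷ []
    LeftStraight⇒L {x} = proj₁ (marking x)

    Rec-balanced-over-LeftMinimal : ∀ {a b c d} → LeftMinimal π c d →
      RightStraight π a → RightStraight π b → Rec π a b c d → Balanced π M a b c d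
    Rec-balanced-over-LeftMinimal {c = c} {d} cd-minimal ra rb rec =
      refinement-induction (position π) (rightStraight? π) Q base step ra rb (proj₁ rec) rec
      where
      Q : Fin n → Fin n → Set
      Q a b = Rec π a b c d → Balanced π M a b c d

      base : ∀ {a b} → RightStraight π a → RightStraight π b → Before π a b →
        NothingBetween (position π) (rightStraight? π) a b → Q a b
      base {a} {b} ra rb a≺b nothing rec =
        minimal-balanced _ _ _ _ (rec , (ra , rb , a<b , nothing) , cd-minimal)
                                 (a<b , proj₁ (proj₂ (proj₂ cd-minimal)))
        where
        a<b : a < b
        a<b = Before⇒<-of-¬IsLeft π (proj₂ rb) a≺b

      step : ∀ {a r b} → RightStraight π a → RightStraight π r → RightStraight π b →
        Before π a r → Before π r b → Q a r → Q r b → Q a b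
      step {a} {r} {b} _ rr rb a≺r r≺b Qar Qrb (_ , b≺c , c≺d , c<a , d<a , c<b , d<b) =
        Balanced-splitᵃᵇ π M (RightStraight⇒R rr) a≺r r≺b a<r r<b
          (Qar (a≺r , Before-trans π r≺b b≺c , c≺d , c<a , d<a , c<r , d<r))
          (Qrb (r≺b , b≺c , c≺d , c<r , d<r , c<b , d<b))
        where
        a<r : a < r
        a<r = Before⇒<-of-¬IsLeft π (proj₂ rr) a≺r
        r<b : r < b
        r<b = Before⇒<-of-¬IsLeft π (proj₂ rb) r≺b
        c<r : c < r
        c<r = <-trans c<a a<r
        d<r : d < r
        d<r = <-trans d<a a<r

    Rec-balanced-of-straight-sides : ∀ {a b c d} →
      RightStraight π a → RightStraight π b → LeftStraight π c → LeftStraight π d →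
      Rec π a b c d → Balanced π M a b c d
    Rec-balanced-of-straight-sides {a} {b} ra rb lc ld rec =
      refinement-induction (position π) (leftStraight? π) Q base step lc ld
                           (proj₁ (proj₂ (proj₂ rec))) rec
      where
      Q : Fin n → Fin n → Set
      Q c d = Rec π a b c d → Balanced π M a b c d

      base : ∀ {c d} → LeftStraight π c → LeftStraight π d → Before π c d →
        NothingBetween (position π) (leftStraight? π) c d → Q c d
      base lc ld c≺d nothing =
        Rec-balanced-over-LeftMinimal
          (lc , ld , Before⇒<-of-¬IsRight π (proj₂ lc) c≺d , nothing) ra rb

      step : ∀ {c l d} → LeftStraight π c → LeftStraight π l → LeftStraight π d →
        Before π c l → Before π l d → Q c l → Q l d → Q c d
      step {c} {l} {d} lc ll _ c≺l l≺d Qcl Qld (a≺b , b≺c , _ , c<a , d<a , c<b , d<b) =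
        Balanced-splitᶜᵈ π M (LeftStraight⇒L ll) c≺l l≺d c<l l<d
          (Qcl (a≺b , b≺c , c≺l , c<a , l<a , c<b , l<b))
          (Qld (a≺b , Before-trans π b≺c c≺l , l≺d , l<a , d<a , l<b , d<b))
        where
        c<l : c < l
        c<l = Before⇒<-of-¬IsRight π (proj₂ lc) c≺l
        l<d : l < d
        l<d = Before⇒<-of-¬IsRight π (proj₂ ll) l≺d
        l<a : l < a
        l<a = <-trans l<d d<a
        l<b : l < b
        l<b = <-trans l<d d<b

    -- In a rec, a and b are right and c and d are left (each of a, b inverts with c,
    -- and a also with d), so straight ones are straight on the expected side.
    StraightRec-balanced : ∀ {a b c d} → Rec π a b c d → StraightRec π a b c d →
      Balanced π M a b c d
    StraightRec-balanced {a} {c = c} rec@(a≺b , b≺c , c≺d , c<a , d<a , c<b , _) (sa , sb , sc , sd) =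
      Rec-balanced-of-straight-sides
        (Straight∧IsRight⇒RightStraight π sa (c , c<a , a≺c))
        (Straight∧IsRight⇒RightStraight π sb (c , c<b , b≺c))
        (Straight∧IsLeft⇒LeftStraight π sc (a , c<a , a≺c))
        (Straight∧IsLeft⇒LeftStraight π sd (a , d<a , Before-trans π a≺c c≺d))
        rec
      where
      a≺c : Before π a c
      a≺c = Before-trans π a≺b b≺c

  MSBalanced⇒SBalanced : IsMarking π M → MSBalanced π M → SBalanced π M
  MSBalanced⇒SBalanced marking (minimal-balanced , irregular-empty) =
    (λ _ _ _ _ → StraightRec-balanced marking minimal-balanced) , irregular-empty

lemma6 : (n : ℕ) (π : Permutation′ n) (M : Fin n → Word) →
    IsMarking π M → (SBalanced π M ⇔ MSBalanced π M)
lemma6 n π M marking = mk⇔ (SBalanced⇒MSBalanced π M) (MSBalanced⇒SBalanced π M marking)
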